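{- Let $P$ be a finite poset, and let $\mathcal F\subseteq 2^X$ and $\mathcal F'\subseteq 2^Y$ be families over finite base sets $X,Y$. If $\mathcal F\gtrsim_1\mathcal F'$ and $\mathcal F$ is induced $P$-saturating (in $2^X$), then $\mathcal F'$ is induced $P$-saturating (in $2^Y$). Consequently, if $\mathcal F\cong_1\mathcal F'$, then $\mathcal F$ is induced $P$-saturating if and only if $\mathcal F'$ is induced $P$-saturating.
   Context: A subfamily $\mathcal G\subseteq\mathcal F\subseteq 2^X$ is an induced copy of a poset $P$ if there is a bijection $i:P\to\mathcal G$ with $p\le_P q$ iff $i(p)\subseteq i(q)$. $\mathcal F\subseteq 2^X$ is induced $P$-saturating if it contains no induced copy of $P$ and for every $G\in 2^X\setminus\mathcal F$, $\mathcal F\cup\{G\}$ contains an induced copy of $P$. For $\mathcal F\subseteq 2^X$, $\mathcal A(\mathcal F)$ is the Boolean algebra of subsets of $X$ generated by $\mathcal F$ under union, intersection and complement (relative to $X$); its atoms are its minimal nonempty members. Write $\mathcal F\gtrsim_1\mathcal F'$ if there is an isomorphism of Boolean algebras $\Phi:\mathcal A(\mathcal F)\to\mathcal A(\mathcal F')$ (preserving union, intersection and complement) whose restriction to $\mathcal F$ is a bijection onto $\mathcal F'$ (hence an inclusion-isomorphism of posets), and such that every atom of $\mathcal A(\mathcal F)$ that is a singleton is mapped by $\Phi$ to a singleton. Write $\mathcal F\cong_1\mathcal F'$ if there is such a $\Phi$ for which an atom of $\mathcal A(\mathcal F)$ is a singleton if and only if its image is a singleton. The base sets $X$ and $Y$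 may have different sizes. -}

module Defs where

open import Data.Nat using (ℕ)
open import Data.Fin using (Fin)
open import Data.Fin.Subset using (Subset; _⊆_; _∪_; _∩_; ∁; ⊥; ⊤; ⁅_⁆; Nonempty)
open import Data.List using (List; _∷_)
open import Data.List.Membership.Propositional using (_∈_)
open import Data.Product using (Σ; ∃; _×_; _,_)
open import Relation.Nullary using (¬_)
open import Relation.Binary.PropositionalEquality using (_≡_)
open import Relation.Binary.Structures using (IsPartialOrder)
open import Function.Definitions using (Injective)

-- A finite family of subsets of the base set X = Fin n (duplicates harmless).
Family : ℕ → Set
Family n = List (Subset n)

record FinPoset : Set₁ where
  field
    size  : ℕ
    _≤P_  : Fin size → Fin size → Set
    isPO  : IsPartialOrder _≡_ _≤P_
open FinPoset public

-- 𝒢 ⊆ ℱ is an induced copy of P: a bijection i : P → 𝒢 (i.e. an injective map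
-- into ℱ, 𝒢 being its image) with p ≤ q iff i p ⊆ i q.
record InducedCopy (P : FinPoset) {n : ℕ} (ℱ : Family n) : Set where
  field
    emb       : Fin (size P) → Subset n
    injective : Injective _≡_ _≡_ emb
    inFamily  : ∀ p → emb p ∈ ℱ
    order⇒⊆   : ∀ p q → _≤P_ P p q → emb p ⊆ emb q
    ⊆⇒order   : ∀ p q → emb p ⊆ emb q → _≤P_ P p q

ContainsInduced : FinPoset → {n : ℕ} → Family n → Set
ContainsInduced P ℱ = InducedCopy P ℱ

InducedSaturating : FinPoset → {n : ℕ} → Family n → Set
InducedSaturating P {n} ℱ =
  (¬ ContainsInduced P ℱ) ×
  (∀ (G : Subset n) → ¬ (G ∈ ℱ) → ContainsInduced P (G ∷ ℱ))

data InAlg {n : ℕ} (ℱ : Family n) : Subset n → Set where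
  gen   : ∀ {A} → A ∈ ℱ → InAlg ℱ A
  empty : InAlg ℱ ⊥
  full  : InAlg ℱ ⊤
  union : ∀ {A B} → InAlg ℱ A → InAlg ℱ B → InAlg ℱ (A ∪ B)
  inter : ∀ {A B} → InAlg ℱ A → InAlg ℱ B → InAlg ℱ (A ∩ B)
  compl : ∀ {A} → InAlg ℱ A → InAlg ℱ (∁ A)

IsAtom : {n : ℕ} → Family n → Subset n → Set
IsAtom {n} ℱ A =
  InAlg ℱ A × Nonempty A ×
  (∀ (B : Subset n) → InAlg ℱ B → Nonempty B → B ⊆ A → B ≡ A)

IsSingleton : {n : ℕ} → Subset n → Set
IsSingleton {n} A = ∃ λ (x : Fin n) → A ≡ ⁅ x ⁆

-- A Boolean-algebra isomorphism Φ : 𝒜(ℱ) → 𝒜(ℱ') restricting to a bijection ℱ → ℱ'.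
-- Φ is given as a function on all subsets; only its values on 𝒜(ℱ) matter.
record AlgIso {n m : ℕ} (ℱ : Family n) (ℱ' : Family m) : Set where
  field
    Φ          : Subset n → Subset m
    into       : ∀ {A} → InAlg ℱ A → InAlg ℱ' (Φ A)
    onto       : ∀ {B} → InAlg ℱ' B → ∃ λ A → InAlg ℱ A × Φ A ≡ B
    injective  : ∀ {A B} → InAlg ℱ A → InAlg ℱ B → Φ A ≡ Φ B → A ≡ B
    pres-∪     : ∀ {A B} → InAlg ℱ A → InAlg ℱ B → Φ (A ∪ B) ≡ Φ A ∪ Φ B
    pres-∩     : ∀ {A B} → InAlg ℱ A → InAlg ℱ B → Φ (A ∩ B) ≡ Φ A ∩ Φ B
    pres-∁     : ∀ {A} → InAlg ℱ A → Φ (∁ A) ≡ ∁ (Φ A)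
    fam-into   : ∀ {A} → A ∈ ℱ → Φ A ∈ ℱ'
    fam-onto   : ∀ {B} → B ∈ ℱ' → ∃ λ A → A ∈ ℱ × Φ A ≡ B
open AlgIso public

record _≳₁_ {n m : ℕ} (ℱ : Family n) (ℱ' : Family m) : Set where
  field
    iso       : AlgIso ℱ ℱ'
    singleton : ∀ {A} → IsAtom ℱ A → IsSingleton A → IsSingleton (Φ iso A)

record _≅₁_ {n m : ℕ} (ℱ : Family n) (ℱ' : Family m) : Set where
  field
    iso        : AlgIso ℱ ℱ'
    singleton  : ∀ {A} → IsAtom ℱ A → IsSingleton A → IsSingleton (Φ iso A)
    singleton⁻ : ∀ {A} → IsAtom ℱ A → IsSingleton (Φ iso A) → IsSingleton A

-- Every point x of X has a signature: the list of bits saying which members of ℱ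
-- contain x. The atoms of 𝒜(ℱ) are exactly the nonempty signature classes, and Φ,
-- preserving ∩ and ∁, maps the class of a signature in X onto the class of the same
-- signature in Y (with respect to Φ ℱ). Hence X and Y realise the same signatures,
-- and whether A ⊆ B for members of ℱ can be read off from the realised signatures
-- alone, so Φ is an order isomorphism ℱ → ℱ' and induced copies of P move across.
-- For a new set G' ⊆ Y we build G ⊆ X realising the same refined signatures: on a
-- class that G' meets only partly, G takes the least point of the class; this class
-- has at least two points in Y, hence (by the singleton condition) in X, so G meets
-- it only partly too. Then G ↦ G' extends Φ to an order isomorphism
-- G ∷ ℱ → G' ∷ ℱ', and G ∉ ℱ because G' ∉ ℱ'.
module Submission where

open import Defs
open import Data.Bool using (Bool; true; false)
import Data.Bool.Properties as Bool
open import Data.Empty using (⊥-elim)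
open import Data.Fin using (Fin; zero; suc; _≤_; _≤?_)
open import Data.Fin.Properties using (any?; all?; ≤-antisym) renaming (_≟_ to _≟ᶠ_)
open import Data.Fin.Subset using (Subset; _⊆_; _∪_; _∩_; ∁; ⊥; ⊤; ⁅_⁆; Nonempty)
  renaming (_∈_ to _∈ₛ_; _∉_ to _∉ₛ_)
open import Data.Fin.Subset.Properties
  using (⊆-refl; ⊆-reflexive; ⊆-antisym; Empty-unique; nonempty?; ∉⊥; ∈⊤;
         x∈⁅x⁆; x∈⁅y⁆⇒x≡y; x∈∁p⇒x∉p; x∉p⇒x∈∁p; x∈p∩q⁺; x∈p∩q⁻; x∈p∪q⁺; x∈p∪q⁻;
         p∪∁p≡⊤; ∩-inverseʳ)
  renaming (_∈?_ to _∈ₛ?_)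
open import Data.List using (List; []; _∷_; map)
import Data.List.Properties as List
open import Data.List.Membership.Propositional using (_∈_)
open import Data.List.Relation.Unary.All as All using (All; []; _∷_)
open import Data.List.Relation.Unary.Any using (here; there)
open import Data.Nat using (ℕ; z≤n; s≤s)
open import Data.Product using (∃; _×_; _,_; proj₁; proj₂; swap)
open import Data.Product.Properties using (,-injectiveˡ; ,-injectiveʳ)
open import Data.Sum using (_⊎_; inj₁; inj₂)
open import Data.Vec using (lookup; tabulate)
open import Data.Vec.Properties using ([]=⇒lookup; lookup⇒[]=; lookup∘tabulate)
open import Function using (_∘_; flip)
open import Function.Bundles using (_⇔_; mk⇔; Equivalence)
open import Relation.Binary.Definitions using (DecidableEquality)
open import Relation.Binary.PropositionalEquality
  using (_≡_; _≢_; refl; sym; trans; cong; cong₂; subst; module ≡-Reasoning)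
open import Relation.Nullary using (¬_; yes; no; does; contradiction)
open import Relation.Nullary.Decidable
  using (_×-dec_; _⊎-dec_; _→-dec_; ¬?; dec-true; isYes≗does; decidable-stable; toWitness)
open import Relation.Unary using (Decidable)

open Equivalence using (to; from)

private
  variable
    k n m : ℕ
    S : Set

lookup-≡-∈ : {p : Subset n} {q : Subset m} {x : Fin n} {y : Fin m} →
             y ∈ₛ q → x ∈ₛ p → lookup q y ≡ lookup p x
lookup-≡-∈ y∈q x∈p = trans ([]=⇒lookup y∈q) (sym ([]=⇒lookup x∈p))

∉⇒lookup≡false : {p : Subset n} {x : Fin n} → x ∉ₛ p → lookup p x ≡ false
∉⇒lookup≡false {p = p} {x} x∉p with lookup p x in eq
... | true  = contradiction (lookup⇒[]= x p eq) x∉p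
... | false = refl

lookup-≡-∉ : {p : Subset n} {q : Subset m} {x : Fin n} {y : Fin m} →
             y ∉ₛ q → x ∉ₛ p → lookup q y ≡ lookup p x
lookup-≡-∉ y∉q x∉p = trans (∉⇒lookup≡false y∉q) (sym (∉⇒lookup≡false x∉p))

∈-by-lookup : {p : Subset n} {q : Subset m} {x : Fin n} {y : Fin m} →
              lookup q y ≡ lookup p x → x ∈ₛ p → y ∈ₛ q
∈-by-lookup {q = q} {y = y} e x∈p = lookup⇒[]= y q (trans e ([]=⇒lookup x∈p))

select : {P : Fin k → Set} → Decidable P → Subset k
select P? = tabulate (does ∘ P?)

∈-select : {P : Fin k → Set} (P? : Decidable P) {x : Fin k} → x ∈ₛ select P? ⇔ P x
∈-select P? {x} = mk⇔
  (λ x∈ → toWitness {a? = P? x} (from Bool.T-≡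
     (trans (isYes≗does (P? x)) (trans (sym (lookup∘tabulate _ x)) ([]=⇒lookup x∈)))))
  (λ px → lookup⇒[]= x _ (trans (lookup∘tabulate _ x) (dec-true (P? x) px)))

nonempty-if-≢⊥ : {p : Subset n} → p ≢ ⊥ → Nonempty p
nonempty-if-≢⊥ {p = p} p≢⊥ with nonempty? p
... | yes ne = ne
... | no  ¬ne = contradiction (Empty-unique ¬ne) p≢⊥

least-witness : {P : Fin k → Set} → Decidable P → ∃ P → ∃ λ x → P x × (∀ y → P y → x ≤ y)
least-witness P? (zero , p₀) = zero , p₀ , λ _ _ → z≤n
least-witness P? (suc w , pw) with P? zero
... | yes p₀  = zero , p₀ , λ _ _ → z≤n
... | no  ¬p₀ with least-witness (P? ∘ suc) (w , pw)
...   | x , px , minimal =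
  suc x , px , λ { zero p → contradiction p ¬p₀ ; (suc y) p → s≤s (minimal y p) }

¬∃¬⇒∀ : {P Q : Fin k → Set} → Decidable Q →
        ¬ (∃ λ x → P x × ¬ Q x) → ∀ x → P x → Q x
¬∃¬⇒∀ Q? none x px = decidable-stable (Q? x) (λ ¬qx → none (x , px , ¬qx))

map-≡⇒≡ : {A B : Set} {f g : A → B} {xs : List A} {a : A} →
          map f xs ≡ map g xs → a ∈ xs → f a ≡ g a
map-≡⇒≡ {xs = _ ∷ _} e (here refl) = List.∷-injectiveˡ e
map-≡⇒≡ {xs = _ ∷ _} e (there a∈) = map-≡⇒≡ (List.∷-injectiveʳ e) a∈

OrderMatching : (Subset n → Subset m → Set) → Set
OrderMatching R = ∀ {A₁ B₁ A₂ B₂} → R A₁ B₁ → R A₂ B₂ → (A₁ ⊆ A₂ ⇔ B₁ ⊆ B₂)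

OrderMatching-flip : {R : Subset n → Subset m → Set} → OrderMatching R → OrderMatching (flip R)
OrderMatching-flip match r₁ r₂ = let e = match r₁ r₂ in mk⇔ (from e) (to e)

transport-copy : {P : FinPoset} {𝒦 : Family n} {𝒦' : Family m} {R : Subset n → Subset m → Set} →
  OrderMatching R → (∀ {A} → A ∈ 𝒦 → ∃ λ B → B ∈ 𝒦' × R A B) →
  InducedCopy P 𝒦 → InducedCopy P 𝒦'
transport-copy {m = m} {P = P} {R = R} match partner c = record
  { emb       = emb'
  ; injective = λ {p} {q} e → InducedCopy.injective c
      (⊆-antisym (from (match (rel p) (rel q)) (⊆-reflexive e))
                 (from (match (rel q) (rel p)) (⊆-reflexive (sym e))))
  ; inFamily  = λ p → proj₁ (proj₂ (partner (inFamily p)))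
  ; order⇒⊆   = λ p q p≤q → to (match (rel p) (rel q)) (order⇒⊆ p q p≤q)
  ; ⊆⇒order   = λ p q ⊆′ → ⊆⇒order p q (from (match (rel p) (rel q)) ⊆′)
  }
  where
  open InducedCopy c using (emb; inFamily; order⇒⊆; ⊆⇒order)
  emb' : Fin (size P) → Subset m
  emb' p = proj₁ (partner (inFamily p))
  rel : ∀ p → R (emb p) (emb' p)
  rel p = proj₂ (proj₂ (partner (inFamily p)))

Adjoin : Subset n → Subset m → (Subset n → Subset m → Set) → Subset n → Subset m → Set
Adjoin G G' R A B = (A ≡ G × B ≡ G') ⊎ R A B

saturating-transfer : (P : FinPoset) {ℱ : Family n} {ℱ' : Family m} {R : Subset n → Subset m → Set} →
  (∀ {A} → A ∈ ℱ → ∃ λ B → B ∈ ℱ' × R A B) →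
  (∀ {B} → B ∈ ℱ' → ∃ λ A → A ∈ ℱ × R A B) →
  OrderMatching R →
  (∀ G' → ∃ λ G → OrderMatching (Adjoin G G' R)) →
  InducedSaturating P ℱ → InducedSaturating P ℱ'
saturating-transfer {n} P {ℱ} {ℱ'} {R} partner partner⁻ match extend (free , saturated) =
  (λ c → free (transport-copy (OrderMatching-flip match) partner⁻ c)) , saturated'
  where
  saturated' : ∀ G' → ¬ (G' ∈ ℱ') → InducedCopy P (G' ∷ ℱ')
  saturated' G' G'∉ = transport-copy match⁺ partner⁺ (saturated G G∉)
    where
    G : Subset n
    G = proj₁ (extend G')
    match⁺ : OrderMatching (Adjoin G G' R)
    match⁺ = proj₂ (extend G')
    self : Adjoin G G' R G G'
    self = inj₁ (refl , refl)
    G∉ : ¬ (G ∈ ℱ)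
    G∉ G∈ with partner G∈
    ... | B , B∈ , r = G'∉ (subst (_∈ ℱ') (⊆-antisym (to (match⁺ (inj₂ r) self) ⊆-refl)
                                                      (to (match⁺ self (inj₂ r)) ⊆-refl)) B∈)
    partner⁺ : ∀ {A} → A ∈ G ∷ ℱ → ∃ λ B → B ∈ G' ∷ ℱ' × Adjoin G G' R A B
    partner⁺ (here refl) = G' , here refl , self
    partner⁺ (there A∈) = let (B , B∈ , r) = partner A∈ in B , there B∈ , inj₂ r

SameImage : {A B C : Set} → (A → C) → (B → C) → Set
SameImage f g = (∀ x → ∃ λ y → g y ≡ f x) × (∀ y → ∃ λ x → f x ≡ g y)

Respects : (Fin n → S) → (Fin m → S) → (Subset n → Subset m → Set) → Set
Respects σ σ' R = ∀ {A B x y} → R A B → σ' y ≡ σ x → lookup B y ≡ lookup A x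

Respects-flip : {σ : Fin n → S} {σ' : Fin m → S} {R : Subset n → Subset m → Set} →
                Respects σ σ' R → Respects σ' σ (flip R)
Respects-flip resp {B} {A} {y} {x} r e = sym (resp {A} {B} {x} {y} r (sym e))

⊆-transfer : {σ : Fin n → S} {σ' : Fin m → S} {R : Subset n → Subset m → Set} →
  (∀ y → ∃ λ x → σ x ≡ σ' y) → Respects σ σ' R →
  ∀ {A₁ B₁ A₂ B₂} → R A₁ B₁ → R A₂ B₂ → A₁ ⊆ A₂ → B₁ ⊆ B₂
⊆-transfer twin resp r₁ r₂ A₁⊆A₂ {y} y∈B₁ =
  let (x , e) = twin y
  in ∈-by-lookup (resp r₂ (sym e)) (A₁⊆A₂ (∈-by-lookup (sym (resp r₁ (sym e))) y∈B₁))

sameImage⇒orderMatching : {σ : Fin n → S} {σ' : Fin m → S} {R : Subset n → Subset m → Set} →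
  SameImage σ σ' → Respects σ σ' R → OrderMatching R
sameImage⇒orderMatching {σ = σ} {σ'} {R} (twin , twin⁻) resp r₁ r₂ =
  mk⇔ (⊆-transfer twin⁻ resp r₁ r₂) (⊆-transfer twin (Respects-flip {σ = σ} {σ'} {R} resp) r₁ r₂)

refine : Subset k → (Fin k → S) → Fin k → Bool × S
refine G σ x = lookup G x , σ x

Respects-adjoin : {σ : Fin n → S} {σ' : Fin m → S} {R : Subset n → Subset m → Set}
  {G : Subset n} {G' : Subset m} →
  Respects σ σ' R → Respects (refine G σ) (refine G' σ') (Adjoin G G' R)
Respects-adjoin resp (inj₁ (refl , refl)) e = ,-injectiveˡ e
Respects-adjoin resp (inj₂ r) e = resp r (,-injectiveʳ e)

SingletonFibre : (Fin k → S) → Fin k → Set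
SingletonFibre σ x = ∀ x' → σ x' ≡ σ x → x' ≡ x

PreservesSingletonFibres : (Fin n → S) → (Fin m → S) → Set
PreservesSingletonFibres σ σ' =
  ∀ x → SingletonFibre σ x → ∀ {y₁ y₂} → σ' y₁ ≡ σ x → σ' y₂ ≡ σ x → y₁ ≡ y₂

module Refinement (_≟_ : DecidableEquality S) {σ : Fin n → S} {σ' : Fin m → S}
  (image : SameImage σ σ') (singletons : PreservesSingletonFibres σ σ') (G' : Subset m) where

  Hit Covered Least Chosen : Fin n → Set
  Hit     x = ∃ λ y → σ' y ≡ σ x × y ∈ₛ G'
  Covered x = ∀ y → σ' y ≡ σ x → y ∈ₛ G'
  Least   x = ∀ x' → σ x' ≡ σ x → x ≤ x'
  Chosen  x = Hit x × (Covered x ⊎ Least x)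

  chosen? : Decidable Chosen
  chosen? x =
    any? (λ y → σ' y ≟ σ x ×-dec y ∈ₛ? G') ×-dec
    (all? (λ y → σ' y ≟ σ x →-dec y ∈ₛ? G') ⊎-dec all? (λ x' → σ x' ≟ σ x →-dec x ≤? x'))

  G : Subset n
  G = select chosen?

  least-of-fibre : ∀ y → ∃ λ x → σ x ≡ σ' y × Least x
  least-of-fibre y with least-witness (λ x → σ x ≟ σ' y) (proj₂ image y)
  ... | x , e , minimal = x , e , λ x' e' → minimal x' (trans e' e)

  unchosen⇒twin∉ : ∀ {x} → ¬ Chosen x → ∃ λ y → σ' y ≡ σ x × y ∉ₛ G'
  unchosen⇒twin∉ {x} ¬chosen with any? (λ y → σ' y ≟ σ x ×-dec ¬? (y ∈ₛ? G'))
  ... | yes twin = twin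
  ... | no  none = contradiction (hit , inj₁ covered) ¬chosen
    where
    covered : Covered x
    covered = ¬∃¬⇒∀ (_∈ₛ? G') none
    hit : Hit x
    hit = let (y , e) = proj₁ image x in y , e , covered y e

  ∈⇒twin-chosen : ∀ {y} → y ∈ₛ G' → ∃ λ x → σ x ≡ σ' y × Chosen x
  ∈⇒twin-chosen {y} y∈ =
    let (x , e , least) = least-of-fibre y in x , e , (y , sym e , y∈) , inj₂ least

  -- A partly hit class of Y is not a singleton, so neither is its twin class of X;
  -- a point of the latter other than the least one is not chosen.
  ∉⇒twin-unchosen : ∀ {y} → y ∉ₛ G' → ∃ λ x → σ x ≡ σ' y × ¬ Chosen x
  ∉⇒twin-unchosen {y} y∉ with any? (λ y₁ → σ' y₁ ≟ σ' y ×-dec y₁ ∈ₛ? G')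
  ... | no none = let (x , e) = proj₂ image y in
        x , e , λ ((y₁ , e₁ , y₁∈) , _) → none (y₁ , trans e₁ e , y₁∈)
  ... | yes (y₁ , e₁ , y₁∈) with least-of-fibre y
  ...   | x₀ , e₀ , least₀ with any? (λ x → σ x ≟ σ x₀ ×-dec ¬? (x ≟ᶠ x₀))
  ...     | no alone = contradiction (subst (_∈ₛ G') y₁≡y y₁∈) y∉
    where
    y₁≡y : y₁ ≡ y
    y₁≡y = singletons x₀ (¬∃¬⇒∀ (_≟ᶠ x₀) alone) (trans e₁ (sym e₀)) (sym e₀)
  ...     | yes (x , e , x≢x₀) = x , trans e e₀ , unchosen
    where
    unchosen : ¬ Chosen x
    unchosen (_ , inj₁ covered) = y∉ (covered y (sym (trans e e₀)))
    unchosen (_ , inj₂ least)   = x≢x₀ (≤-antisym (least x₀ (sym e)) (least₀ x e))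

  refined-sameImage : SameImage (refine G σ) (refine G' σ')
  refined-sameImage = twin , twin⁻
    where
    twin : ∀ x → ∃ λ y → refine G' σ' y ≡ refine G σ x
    twin x with chosen? x
    ... | yes chosen = let (y , e , y∈) = proj₁ chosen in
          y , cong₂ _,_ (lookup-≡-∈ y∈ (from (∈-select chosen?) chosen)) e
    ... | no ¬chosen = let (y , e , y∉) = unchosen⇒twin∉ ¬chosen in
          y , cong₂ _,_ (lookup-≡-∉ y∉ (¬chosen ∘ to (∈-select chosen?))) e
    twin⁻ : ∀ y → ∃ λ x → refine G σ x ≡ refine G' σ' y
    twin⁻ y with y ∈ₛ? G'
    ... | yes y∈ = let (x , e , chosen) = ∈⇒twin-chosen y∈ in
          x , cong₂ _,_ (lookup-≡-∈ (from (∈-select chosen?) chosen) y∈) e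
    ... | no  y∉ = let (x , e , ¬chosen) = ∉⇒twin-unchosen y∉ in
          x , cong₂ _,_ (lookup-≡-∉ (¬chosen ∘ to (∈-select chosen?)) y∉) e

saturating-transfer-by-signatures : (P : FinPoset) (_≟_ : DecidableEquality S)
  {ℱ : Family n} {ℱ' : Family m} {σ : Fin n → S} {σ' : Fin m → S} {R : Subset n → Subset m → Set} →
  SameImage σ σ' → Respects σ σ' R → PreservesSingletonFibres σ σ' →
  (∀ {A} → A ∈ ℱ → ∃ λ B → B ∈ ℱ' × R A B) →
  (∀ {B} → B ∈ ℱ' → ∃ λ A → A ∈ ℱ × R A B) →
  InducedSaturating P ℱ → InducedSaturating P ℱ'
saturating-transfer-by-signatures P _≟_ {R = R} image resp singletons partner partner⁻ =
  saturating-transfer P partner partner⁻ (sameImage⇒orderMatching image resp) λ G' →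
    let open Refinement _≟_ image singletons G' in
    G , sameImage⇒orderMatching refined-sameImage (Respects-adjoin {R = R} {G = G} {G' = G'} resp)

signature : List (Subset k) → Fin k → List Bool
signature L x = map (λ F → lookup F x) L

literal : Bool → Subset k → Subset k
literal true  F = F
literal false F = ∁ F

cell : List (Subset k) → List Bool → Subset k
cell []      []      = ⊤
cell (F ∷ L) (b ∷ t) = literal b F ∩ cell L t
cell _       _       = ⊥

∈-literal⇒ : ∀ b {F : Subset k} {x} → x ∈ₛ literal b F → lookup F x ≡ b
∈-literal⇒ true  x∈ = []=⇒lookup x∈
∈-literal⇒ false x∈ = ∉⇒lookup≡false (x∈∁p⇒x∉p x∈)

∈-literal-lookup : (F : Subset k) (x : Fin k) → x ∈ₛ literal (lookup F x) F
∈-literal-lookup F x with lookup F x in eq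
... | true  = lookup⇒[]= x F eq
... | false = x∉p⇒x∈∁p (λ x∈ → contradiction (trans (sym ([]=⇒lookup x∈)) eq) λ ())

∈-cell⇒ : ∀ L t {x : Fin k} → x ∈ₛ cell L t → signature L x ≡ t
∈-cell⇒ []      []      _  = refl
∈-cell⇒ []      (_ ∷ _) x∈ = ⊥-elim (∉⊥ x∈)
∈-cell⇒ (_ ∷ _) []      x∈ = ⊥-elim (∉⊥ x∈)
∈-cell⇒ (F ∷ L) (b ∷ t) x∈ =
  let (x∈F , x∈L) = x∈p∩q⁻ (literal b F) (cell L t) x∈
  in cong₂ _∷_ (∈-literal⇒ b x∈F) (∈-cell⇒ L t x∈L)

∈-cell-signature : ∀ L (x : Fin k) → x ∈ₛ cell L (signature L x)
∈-cell-signature []      x = ∈⊤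
∈-cell-signature (F ∷ L) x = x∈p∩q⁺ (∈-literal-lookup F x , ∈-cell-signature L x)

∈-cell⇔ : ∀ L t {x : Fin k} → x ∈ₛ cell L t ⇔ signature L x ≡ t
∈-cell⇔ L t {x} = mk⇔ (∈-cell⇒ L t) (λ e → subst (λ t → x ∈ₛ cell L t) e (∈-cell-signature L x))

cell-singleton : ∀ L {x : Fin k} → SingletonFibre (signature L) x → cell L (signature L x) ≡ ⁅ x ⁆
cell-singleton L {x} single = ⊆-antisym
  (λ {x'} x'∈ → subst (_∈ₛ ⁅ x ⁆) (sym (single x' (∈-cell⇒ L _ x'∈))) (x∈⁅x⁆ x))
  (λ {x'} x'∈ → subst (_∈ₛ cell L (signature L x)) (sym (x∈⁅y⁆⇒x≡y x x'∈)) (∈-cell-signature L x))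

lookup-signature : {L : List (Subset n)} (φ : Subset n → Subset m)
  {F : Subset n} {x : Fin n} {y : Fin m} →
  F ∈ L → signature (map φ L) y ≡ signature L x → lookup (φ F) y ≡ lookup F x
lookup-signature {L = L} φ F∈ e = map-≡⇒≡ (trans (List.map-∘ L) e) F∈

module _ {ℱ : Family n} where

  InAlg-respects-signature : ∀ {B x x'} → InAlg ℱ B → signature ℱ x ≡ signature ℱ x' →
                             x ∈ₛ B → x' ∈ₛ B
  InAlg-respects-signature (gen F∈) e x∈ = ∈-by-lookup (sym (map-≡⇒≡ e F∈)) x∈
  InAlg-respects-signature empty e x∈ = ⊥-elim (∉⊥ x∈)
  InAlg-respects-signature full e x∈ = ∈⊤
  InAlg-respects-signature (union {A} {B} a b) e x∈ with x∈p∪q⁻ A B x∈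
  ... | inj₁ x∈A = x∈p∪q⁺ (inj₁ (InAlg-respects-signature a e x∈A))
  ... | inj₂ x∈B = x∈p∪q⁺ (inj₂ (InAlg-respects-signature b e x∈B))
  InAlg-respects-signature (inter {A} {B} a b) e x∈ =
    let (x∈A , x∈B) = x∈p∩q⁻ A B x∈
    in x∈p∩q⁺ (InAlg-respects-signature a e x∈A , InAlg-respects-signature b e x∈B)
  InAlg-respects-signature (compl a) e x∈ =
    x∉p⇒x∈∁p (x∈∁p⇒x∉p x∈ ∘ InAlg-respects-signature a (sym e))

  literal-InAlg : ∀ b {F} → InAlg ℱ F → InAlg ℱ (literal b F)
  literal-InAlg true  a = a
  literal-InAlg false a = compl a

  cell-InAlg : ∀ {L} → All (InAlg ℱ) L → ∀ t → InAlg ℱ (cell L t)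
  cell-InAlg []       []      = full
  cell-InAlg []       (_ ∷ _) = empty
  cell-InAlg (_ ∷ _)  []      = empty
  cell-InAlg (a ∷ as) (b ∷ t) = inter (literal-InAlg b a) (cell-InAlg as t)

  cell-isAtom : ∀ t → Nonempty (cell ℱ t) → IsAtom ℱ (cell ℱ t)
  cell-isAtom t (x , x∈) =
    cell-InAlg (All.tabulate gen) t , (x , x∈) , λ B b (x' , x'∈B) B⊆ → ⊆-antisym B⊆ λ x''∈ →
      InAlg-respects-signature b (trans (∈-cell⇒ ℱ t (B⊆ x'∈B)) (sym (∈-cell⇒ ℱ t x''∈))) x'∈B

module _ {ℱ : Family n} {ℱ' : Family m} (I : AlgIso ℱ ℱ') where
  open ≡-Reasoning

  Φ-⊤ : Φ I ⊤ ≡ ⊤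
  Φ-⊤ = begin
    Φ I ⊤                   ≡⟨ cong (Φ I) (sym (p∪∁p≡⊤ ⊥)) ⟩
    Φ I (⊥ ∪ ∁ ⊥)           ≡⟨ pres-∪ I empty (compl empty) ⟩
    Φ I ⊥ ∪ Φ I (∁ ⊥)       ≡⟨ cong (Φ I ⊥ ∪_) (pres-∁ I empty) ⟩
    Φ I ⊥ ∪ ∁ (Φ I ⊥)       ≡⟨ p∪∁p≡⊤ (Φ I ⊥) ⟩
    ⊤                       ∎

  Φ-⊥ : Φ I ⊥ ≡ ⊥
  Φ-⊥ = begin
    Φ I ⊥                   ≡⟨ cong (Φ I) (sym (∩-inverseʳ ⊤)) ⟩
    Φ I (⊤ ∩ ∁ ⊤)           ≡⟨ pres-∩ I full (compl full) ⟩
    Φ I ⊤ ∩ Φ I (∁ ⊤)       ≡⟨ cong (Φ I ⊤ ∩_) (pres-∁ I full) ⟩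
    Φ I ⊤ ∩ ∁ (Φ I ⊤)       ≡⟨ ∩-inverseʳ (Φ I ⊤) ⟩
    ⊥                       ∎

  Φ-literal : ∀ b {F} → InAlg ℱ F → Φ I (literal b F) ≡ literal b (Φ I F)
  Φ-literal true  a = refl
  Φ-literal false a = pres-∁ I a

  Φ-cell : ∀ {L} → All (InAlg ℱ) L → ∀ t → Φ I (cell L t) ≡ cell (map (Φ I) L) t
  Φ-cell []       []      = Φ-⊤
  Φ-cell []       (_ ∷ _) = Φ-⊥
  Φ-cell (_ ∷ _)  []      = Φ-⊥
  Φ-cell {F ∷ L} (a ∷ as) (b ∷ t) = begin
    Φ I (literal b F ∩ cell L t)              ≡⟨ pres-∩ I (literal-InAlg b a) (cell-InAlg as t) ⟩
    Φ I (literal b F) ∩ Φ I (cell L t)        ≡⟨ cong₂ _∩_ (Φ-literal b a) (Φ-cell as t) ⟩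
    literal b (Φ I F) ∩ cell (map (Φ I) L) t  ∎

  Φ-nonempty : ∀ {A} → InAlg ℱ A → Nonempty A → Nonempty (Φ I A)
  Φ-nonempty a (x , x∈) = nonempty-if-≢⊥ λ ΦA≡⊥ →
    ∉⊥ (subst (x ∈ₛ_) (injective I a empty (trans ΦA≡⊥ (sym Φ-⊥))) x∈)

  Φ-nonempty⁻ : ∀ {A} → Nonempty (Φ I A) → Nonempty A
  Φ-nonempty⁻ (y , y∈) = nonempty-if-≢⊥ λ A≡⊥ →
    ∉⊥ (subst (y ∈ₛ_) (trans (cong (Φ I) A≡⊥) Φ-⊥) y∈)

  σ : Fin n → List Bool
  σ = signature ℱ

  σ' : Fin m → List Bool
  σ' = signature (map (Φ I) ℱ)

  Graph : Subset n → Subset m → Set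
  Graph A B = A ∈ ℱ × Φ I A ≡ B

  ∈-Φ-cell⇔ : ∀ t {y} → y ∈ₛ Φ I (cell ℱ t) ⇔ σ' y ≡ t
  ∈-Φ-cell⇔ t {y} = let e = Φ-cell (All.tabulate gen) t in
    mk⇔ (to (∈-cell⇔ _ t) ∘ subst (y ∈ₛ_) e) (subst (y ∈ₛ_) (sym e) ∘ from (∈-cell⇔ _ t))

  signature-sameImage : SameImage σ σ'
  signature-sameImage = twin , twin⁻
    where
    twin : ∀ x → ∃ λ y → σ' y ≡ σ x
    twin x with Φ-nonempty (cell-InAlg (All.tabulate gen) (σ x)) (x , ∈-cell-signature ℱ x)
    ... | y , y∈ = y , to (∈-Φ-cell⇔ (σ x)) y∈
    twin⁻ : ∀ y → ∃ λ x → σ x ≡ σ' y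
    twin⁻ y with Φ-nonempty⁻ (y , from (∈-Φ-cell⇔ (σ' y)) refl)
    ... | x , x∈ = x , ∈-cell⇒ ℱ (σ' y) x∈

  graph-respects : Respects σ σ' Graph
  graph-respects (F∈ , refl) e = lookup-signature (Φ I) F∈ e

  graph-partner : ∀ {A} → A ∈ ℱ → ∃ λ B → B ∈ ℱ' × Graph A B
  graph-partner A∈ = Φ I _ , fam-into I A∈ , A∈ , refl

  graph-partner⁻ : ∀ {B} → B ∈ ℱ' → ∃ λ A → A ∈ ℱ × Graph A B
  graph-partner⁻ B∈ = let (A , A∈ , e) = fam-onto I B∈ in A , A∈ , A∈ , e

  preservesSingletonFibres : (∀ {A} → IsAtom ℱ A → IsSingleton A → IsSingleton (Φ I A)) →
                             PreservesSingletonFibres σ σ'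
  preservesSingletonFibres singleton x single {y₁} {y₂} e₁ e₂
    with singleton (cell-isAtom (σ x) (x , ∈-cell-signature ℱ x)) (x , cell-singleton ℱ single)
  ... | y₀ , Φcell≡⁅y₀⁆ = trans (≡y₀ e₁) (sym (≡y₀ e₂))
    where
    ≡y₀ : ∀ {y} → σ' y ≡ σ x → y ≡ y₀
    ≡y₀ e = x∈⁅y⁆⇒x≡y y₀ (subst (_ ∈ₛ_) Φcell≡⁅y₀⁆ (from (∈-Φ-cell⇔ (σ x)) e))

  reflectsSingletonFibres : (∀ {A} → IsAtom ℱ A → IsSingleton (Φ I A) → IsSingleton A) →
                            PreservesSingletonFibres σ' σ
  reflectsSingletonFibres singleton⁻ y single {x₁} {x₂} e₁ e₂
    with singleton⁻ (cell-isAtom (σ' y) (x₁ , from (∈-cell⇔ ℱ _) e₁))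
                    (y , trans (Φ-cell (All.tabulate gen) (σ' y)) (cell-singleton _ single))
  ... | x₀ , cell≡⁅x₀⁆ = trans (≡x₀ e₁) (sym (≡x₀ e₂))
    where
    ≡x₀ : ∀ {x} → σ x ≡ σ' y → x ≡ x₀
    ≡x₀ e = x∈⁅y⁆⇒x≡y x₀ (subst (_ ∈ₛ_) cell≡⁅x₀⁆ (from (∈-cell⇔ ℱ _) e))

≅₁⇒≳₁ : {ℱ : Family n} {ℱ' : Family m} → ℱ ≅₁ ℱ' → ℱ ≳₁ ℱ'
≅₁⇒≳₁ r = record { iso = _≅₁_.iso r ; singleton = _≅₁_.singleton r }

≳₁-preserves-saturating : (P : FinPoset) {ℱ : Family n} {ℱ' : Family m} →
  ℱ ≳₁ ℱ' → InducedSaturating P ℱ → InducedSaturating P ℱ'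
≳₁-preserves-saturating P {ℱ} {ℱ'} r =
  saturating-transfer-by-signatures P (List.≡-dec Bool._≟_) (signature-sameImage I) (graph-respects I)
    (preservesSingletonFibres I (_≳₁_.singleton r)) (graph-partner I) (graph-partner⁻ I)
  where
  I : AlgIso ℱ ℱ'
  I = _≳₁_.iso r

≅₁-reflects-saturating : (P : FinPoset) {ℱ : Family n} {ℱ' : Family m} →
  ℱ ≅₁ ℱ' → InducedSaturating P ℱ' → InducedSaturating P ℱ
≅₁-reflects-saturating P {ℱ} {ℱ'} r =
  saturating-transfer-by-signatures P (List.≡-dec Bool._≟_) (swap (signature-sameImage I))
    (Respects-flip {R = Graph I} (graph-respects I)) (reflectsSingletonFibres I (_≅₁_.singleton⁻ r))
    (graph-partner⁻ I) (graph-partner I)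
  where
  I : AlgIso ℱ ℱ'
  I = _≅₁_.iso r

proposition14 : (P : FinPoset) {n m : ℕ} (ℱ : Family n) (ℱ' : Family m) →
    ((ℱ ≳₁ ℱ') → InducedSaturating P ℱ → InducedSaturating P ℱ') ×
    ((ℱ ≅₁ ℱ') → (InducedSaturating P ℱ ⇔ InducedSaturating P ℱ'))
proposition14 P ℱ ℱ' =
  ≳₁-preserves-saturating P ,
  λ r → mk⇔ (≳₁-preserves-saturating P (≅₁⇒≳₁ r)) (≅₁-reflects-saturating P r)
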